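{- Let $(P,\sqcup,\sqcap,0,1)$ be an operator structure. Define a binary relation $\le$ on $P$ by $x\le y$ if $x\sqcup y=y$. Then $(P,\le,0,1)$ is a bounded poset (with bottom $0$ and top $1$) satisfying: (a) $x\le y$ if and only if $x\sqcap y=x$; (b) $x\sqcup y=\operatorname{Min}U(x,y)$ for all $x,y\in P$; (c) $x\sqcap y=\operatorname{Max}L(x,y)$ for all $x,y\in P$, where $\operatorname{Min}U$ and $\operatorname{Max}L$ are computed in $(P,\le)$.
   Context: A binary operator on a set $P$ assigns to each pair of elements of $P$ a subset of $P$, and is also defined on pairs of subsets of $P$; elements are identified with singletons, so e.g. "$x\sqcup y=y$" means $x\sqcup y=\{y\}$. An operator structure is $(P,\sqcup,\sqcap,0,1)$ with binary operators $\sqcup,\sqcap$ on $P$ and $0,1\in P$ such that for all $x,y,z\in P$: (i) $x\sqcup x=x$ and $x\sqcap x=x$; (ii) $x\sqcup y=y\sqcup x$ and $x\sqcap y=y\sqcap x$; (iii) $0\sqcup x=x$ and $x\sqcap 1=x$; (iv) $x\sqcup((x\sqcup y)\sqcup z)=0\sqcup((x\sqcup y)\sqcup z)$ and $x\sqcap((x\sqcap y)\sqcap z)=((x\sqcap y)\sqcap z)\sqcap 1$; (v) $(x\sqcap y)\sqcup y=y$ and $x\sqcap(x\sqcup y)=x$; (vi) $z\in x\sqcup y$ if and only if [$x\sqcup z=y\sqcup z=z$, and for every $u\in P$ with $x\sqcup u=y\sqcup u=u\sqcap z=u$ we have $u=z$]; and $z\in x\sqcap y$ if and only if [$z\sqcap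 x=z\sqcap y=z$, and for every $u\in P$ with $u\sqcap x=u\sqcap y=z\sqcup u=u$ we have $u=z$]. In a poset, $L(x,y)$ and $U(x,y)$ are the sets of common lower and upper bounds of $x,y$, and $\operatorname{Max}L(x,y)$, $\operatorname{Min}U(x,y)$ are the sets of maximal elements of $L(x,y)$ and minimal elements of $U(x,y)$. -}

module Defs where

open import Data.Product using (Σ; ∃; _×_; _,_)
open import Relation.Binary.PropositionalEquality using (_≡_)
open import Relation.Unary using (Pred; _⊆_)
open import Level using (0ℓ)

Subset : Set → Set₁
Subset P = Pred P 0ℓ

-- singleton subset (elements are identified with singletons)
｛_｝ : {P : Set} → P → Subset P
｛ x ｝ = λ z → z ≡ x

infix 4 _≐_
_≐_ : {P : Set} → Subset P → Subset P → Set
A ≐ B = (A ⊆ B) × (B ⊆ A)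

BinOp : Set → Set₁
BinOp P = P → P → Subset P

lift : {P : Set} → BinOp P → Subset P → Subset P → Subset P
lift op A B = λ z → Σ _ λ a → Σ _ λ b → A a × B b × op a b z

record OperatorStructure : Set₁ where
  field
    P   : Set
    _⊔_ : BinOp P
    _⊓_ : BinOp P
    𝟘   : P
    𝟙   : P

  _⊔ˢ_ : Subset P → Subset P → Subset P
  _⊔ˢ_ = lift _⊔_
  _⊓ˢ_ : Subset P → Subset P → Subset P
  _⊓ˢ_ = lift _⊓_

  field
    ⊔-idem : ∀ x → x ⊔ x ≐ ｛ x ｝
    ⊓-idem : ∀ x → x ⊓ x ≐ ｛ x ｝
    ⊔-comm : ∀ x y → x ⊔ y ≐ y ⊔ x
    ⊓-comm : ∀ x y → x ⊓ y ≐ y ⊓ x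
    ⊔-0 : ∀ x → 𝟘 ⊔ x ≐ ｛ x ｝
    ⊓-1 : ∀ x → x ⊓ 𝟙 ≐ ｛ x ｝
    ⊔-iv : ∀ x y z →
      ｛ x ｝ ⊔ˢ ((x ⊔ y) ⊔ˢ ｛ z ｝) ≐ ｛ 𝟘 ｝ ⊔ˢ ((x ⊔ y) ⊔ˢ ｛ z ｝)
    ⊓-iv : ∀ x y z →
      ｛ x ｝ ⊓ˢ ((x ⊓ y) ⊓ˢ ｛ z ｝) ≐ ((x ⊓ y) ⊓ˢ ｛ z ｝) ⊓ˢ ｛ 𝟙 ｝
    ⊓⊔-absorb : ∀ x y → (x ⊓ y) ⊔ˢ ｛ y ｝ ≐ ｛ y ｝
    ⊔⊓-absorb : ∀ x y → ｛ x ｝ ⊓ˢ (x ⊔ y) ≐ ｛ x ｝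
    ⊔-char→ : ∀ x y z → (x ⊔ y) z →
      (x ⊔ z ≐ ｛ z ｝) × (y ⊔ z ≐ ｛ z ｝) ×
      (∀ u → x ⊔ u ≐ ｛ u ｝ → y ⊔ u ≐ ｛ u ｝ → u ⊓ z ≐ ｛ u ｝ → u ≡ z)
    ⊔-char← : ∀ x y z →
      (x ⊔ z ≐ ｛ z ｝) → (y ⊔ z ≐ ｛ z ｝) →
      (∀ u → x ⊔ u ≐ ｛ u ｝ → y ⊔ u ≐ ｛ u ｝ → u ⊓ z ≐ ｛ u ｝ → u ≡ z) →
      (x ⊔ y) z
    ⊓-char→ : ∀ x y z → (x ⊓ y) z →
      (z ⊓ x ≐ ｛ z ｝) × (z ⊓ y ≐ ｛ z ｝) ×
      (∀ u → u ⊓ x ≐ ｛ u ｝ → u ⊓ y ≐ ｛ u ｝ → z ⊔ u ≐ ｛ u ｝ → u ≡ z)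
    ⊓-char← : ∀ x y z →
      (z ⊓ x ≐ ｛ z ｝) → (z ⊓ y ≐ ｛ z ｝) →
      (∀ u → u ⊓ x ≐ ｛ u ｝ → u ⊓ y ≐ ｛ u ｝ → z ⊔ u ≐ ｛ u ｝ → u ≡ z) →
      (x ⊓ y) z

  _≤_ : P → P → Set
  x ≤ y = x ⊔ y ≐ ｛ y ｝

module _ {P : Set} (_≤_ : P → P → Set) where
  U : P → P → Subset P
  U x y = λ z → (x ≤ z) × (y ≤ z)

  L : P → P → Subset P
  L x y = λ z → (z ≤ x) × (z ≤ y)

  Min : Subset P → Subset P
  Min A = λ z → A z × (∀ u → A u → u ≤ z → u ≡ z)

  Max : Subset P → Subset P
  Max A = λ z → A z × (∀ u → A u → z ≤ u → u ≡ z)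

-- The induced order is a partial order because each order axiom is a single operator axiom
-- read through x ≤ y ⟺ x ⊔ y = y: reflexivity is idempotence (i), antisymmetry is
-- commutativity (ii), and transitivity is (iv), whose two sides collapse to x ⊔ z and
-- 𝟘 ⊔ z = z once x ⊔ y = y and y ⊔ z = z. The absorption laws (v) show that x ⊔ y = y and
-- x ⊓ y = x say the same thing, and with that translation the characterisations (vi) of
-- x ⊔ y and x ⊓ y are literally Min U(x, y) and Max L(x, y).
module Submission where

open import Defs
open import Level using (0ℓ)
open import Data.Product using (_×_; _,_; proj₁; proj₂)
open import Function.Bundles using (_⇔_; mk⇔)
open import Relation.Binary.PropositionalEquality using (_≡_; refl; sym; isEquivalence)
open import Relation.Binary.Structures using (IsPartialOrder)
open import Relation.Unary.Properties using (≐-trans)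
open import Relation.Unary.Relation.Binary.Equality using (≐-setoid)
import Relation.Binary.Reasoning.Setoid as SetoidReasoning

module _ {P : Set} where

  lift-｛｝ : (op : BinOp P) (a b : P) → lift op ｛ a ｝ ｛ b ｝ ≐ op a b
  lift-｛｝ op a b = (λ { (_ , _ , refl , refl , z∈ab) → z∈ab })
                   , (λ z∈ab → a , b , refl , refl , z∈ab)

  lift-congˡ : (op : BinOp P) {A A′ B : Subset P} → A ≐ A′ → lift op A B ≐ lift op A′ B
  lift-congˡ op (A⊆A′ , A′⊆A) = (λ { (a , b , a∈ , b∈ , z∈ab) → a , b , A⊆A′ a∈ , b∈ , z∈ab })
                              , (λ { (a , b , a∈ , b∈ , z∈ab) → a , b , A′⊆A a∈ , b∈ , z∈ab })

  lift-congʳ : (op : BinOp P) {A B B′ : Subset P} → B ≐ B′ → lift op A B ≐ lift op A B′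
  lift-congʳ op (B⊆B′ , B′⊆B) = (λ { (a , b , a∈ , b∈ , z∈ab) → a , b , a∈ , B⊆B′ b∈ , z∈ab })
                              , (λ { (a , b , a∈ , b∈ , z∈ab) → a , b , a∈ , B′⊆B b∈ , z∈ab })

  ｛｝-injective : {a b : P} → ｛ a ｝ ≐ ｛ b ｝ → a ≡ b
  ｛｝-injective (a⊆b , _) = a⊆b refl

module InducedOrder (S : OperatorStructure) where
  open OperatorStructure S
  open SetoidReasoning (≐-setoid P 0ℓ)

  ≤-reflexive : ∀ {x y} → x ≡ y → x ≤ y
  ≤-reflexive {x} refl = ⊔-idem x

  ≤-trans : ∀ {x y z} → x ≤ y → y ≤ z → x ≤ z
  ≤-trans {x} {y} {z} x≤y y≤z = begin
    x ⊔ z                             ≈⟨ lift-｛｝ _⊔_ x z ⟨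
    ｛ x ｝ ⊔ˢ ｛ z ｝                   ≈⟨ lift-congʳ _⊔_ [x⊔y]⊔z≐z ⟨
    ｛ x ｝ ⊔ˢ ((x ⊔ y) ⊔ˢ ｛ z ｝)      ≈⟨ ⊔-iv x y z ⟩
    ｛ 𝟘 ｝ ⊔ˢ ((x ⊔ y) ⊔ˢ ｛ z ｝)      ≈⟨ lift-congʳ _⊔_ [x⊔y]⊔z≐z ⟩
    ｛ 𝟘 ｝ ⊔ˢ ｛ z ｝                   ≈⟨ lift-｛｝ _⊔_ 𝟘 z ⟩
    𝟘 ⊔ z                             ≈⟨ ⊔-0 z ⟩
    ｛ z ｝                            ∎
    where
    [x⊔y]⊔z≐z : (x ⊔ y) ⊔ˢ ｛ z ｝ ≐ ｛ z ｝
    [x⊔y]⊔z≐z = ≐-trans (lift-congˡ _⊔_ x≤y) (≐-trans (lift-｛｝ _⊔_ y z) y≤z)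

  ≤-antisym : ∀ {x y} → x ≤ y → y ≤ x → x ≡ y
  ≤-antisym {x} {y} x≤y (y⊔x⊆x , _) = sym (y⊔x⊆x (proj₁ (⊔-comm x y) (proj₂ x≤y refl)))

  ≤-isPartialOrder : IsPartialOrder _≡_ _≤_
  ≤-isPartialOrder = record
    { isPreorder = record
      { isEquivalence = isEquivalence
      ; reflexive     = ≤-reflexive
      ; trans         = ≤-trans
      }
    ; antisym = ≤-antisym
    }

  ⊓≐⇒≤ : ∀ x y → x ⊓ y ≐ ｛ x ｝ → x ≤ y
  ⊓≐⇒≤ x y x⊓y≐x = begin
    x ⊔ y                ≈⟨ lift-｛｝ _⊔_ x y ⟨
    ｛ x ｝ ⊔ˢ ｛ y ｝      ≈⟨ lift-congˡ _⊔_ x⊓y≐x ⟨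
    (x ⊓ y) ⊔ˢ ｛ y ｝     ≈⟨ ⊓⊔-absorb x y ⟩
    ｛ y ｝               ∎

  ≤⇒⊓≐ : ∀ x y → x ≤ y → x ⊓ y ≐ ｛ x ｝
  ≤⇒⊓≐ x y x≤y = begin
    x ⊓ y                ≈⟨ lift-｛｝ _⊓_ x y ⟨
    ｛ x ｝ ⊓ˢ ｛ y ｝      ≈⟨ lift-congʳ _⊓_ x≤y ⟨
    ｛ x ｝ ⊓ˢ (x ⊔ y)     ≈⟨ ⊔⊓-absorb x y ⟩
    ｛ x ｝               ∎

  ≤⇔⊓≐ : ∀ x y → (x ≤ y) ⇔ (x ⊓ y ≐ ｛ x ｝)
  ≤⇔⊓≐ x y = mk⇔ (≤⇒⊓≐ x y) (⊓≐⇒≤ x y)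

  𝟘-minimum : ∀ x → 𝟘 ≤ x
  𝟘-minimum = ⊔-0

  𝟙-maximum : ∀ x → x ≤ 𝟙
  𝟙-maximum x = ⊓≐⇒≤ x 𝟙 (⊓-1 x)

  ⊔≐MinU : ∀ x y → x ⊔ y ≐ Min _≤_ (U _≤_ x y)
  ⊔≐MinU x y = ⊔⊆MinU , MinU⊆⊔
    where
    ⊔⊆MinU : ∀ {z} → (x ⊔ y) z → Min _≤_ (U _≤_ x y) z
    ⊔⊆MinU {z} z∈x⊔y with ⊔-char→ x y z z∈x⊔y
    ... | x≤z , y≤z , least = (x≤z , y≤z) , λ u (x≤u , y≤u) u≤z → least u x≤u y≤u (≤⇒⊓≐ u z u≤z)

    MinU⊆⊔ : ∀ {z} → Min _≤_ (U _≤_ x y) z → (x ⊔ y) z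
    MinU⊆⊔ {z} ((x≤z , y≤z) , minimal) =
      ⊔-char← x y z x≤z y≤z λ u x≤u y≤u u⊓z≐u → minimal u (x≤u , y≤u) (⊓≐⇒≤ u z u⊓z≐u)

  ⊓≐MaxL : ∀ x y → x ⊓ y ≐ Max _≤_ (L _≤_ x y)
  ⊓≐MaxL x y = ⊓⊆MaxL , MaxL⊆⊓
    where
    ⊓⊆MaxL : ∀ {z} → (x ⊓ y) z → Max _≤_ (L _≤_ x y) z
    ⊓⊆MaxL {z} z∈x⊓y with ⊓-char→ x y z z∈x⊓y
    ... | z⊓x≐z , z⊓y≐z , greatest =
      (⊓≐⇒≤ z x z⊓x≐z , ⊓≐⇒≤ z y z⊓y≐z) ,
      λ u (u≤x , u≤y) z≤u → greatest u (≤⇒⊓≐ u x u≤x) (≤⇒⊓≐ u y u≤y) z≤u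

    MaxL⊆⊓ : ∀ {z} → Max _≤_ (L _≤_ x y) z → (x ⊓ y) z
    MaxL⊆⊓ {z} ((z≤x , z≤y) , maximal) =
      ⊓-char← x y z (≤⇒⊓≐ z x z≤x) (≤⇒⊓≐ z y z≤y)
        λ u u⊓x≐u u⊓y≐u z≤u → maximal u (⊓≐⇒≤ u x u⊓x≐u , ⊓≐⇒≤ u y u⊓y≐u) z≤u

theorem3p3 : (S : OperatorStructure) → let open OperatorStructure S in
    IsPartialOrder _≡_ _≤_ ×
    (∀ x → 𝟘 ≤ x) × (∀ x → x ≤ 𝟙) ×
    (∀ x y → (x ≤ y) ⇔ (x ⊓ y ≐ ｛ x ｝)) ×
    (∀ x y → x ⊔ y ≐ Min _≤_ (U _≤_ x y)) ×
    (∀ x y → x ⊓ y ≐ Max _≤_ (L _≤_ x y))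
theorem3p3 S = ≤-isPartialOrder , 𝟘-minimum , 𝟙-maximum , ≤⇔⊓≐ , ⊔≐MinU , ⊓≐MaxL
  where open InducedOrder S
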